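{- Let $r\ge2$, $t$ and $k$ be positive integers. Let $H=(V,E)$ be an $r$-uniform hypergraph of maximum degree $\Delta$. If \[ \frac{t!}{t+1}\left(\frac{k}{\Delta}\right)^t\ge\mathrm{e}\,r, \] then there exists a partition of $E$ into $k$ pairwise disjoint $t$-shallow edge sets $M_1,\dots,M_k$.
   Context: A hypergraph $H=(V,E)$ has a finite vertex set and a finite multiset of edges (subsets of $V$); it is $r$-uniform if each edge has $r$ vertices. An edge set $M\subseteq E$ is $t$-shallow if every vertex lies in at most $t$ edges of $M$. -}

module Defs where

open import Data.Nat using (ℕ; zero; suc; _+_; _*_; _^_; _≤_; _⊔_; _∸_; _!)

open import Data.Fin using (Fin)
open import Data.Fin.Subset using (Subset; _∈_; ∣_∣)
open import Data.Fin.Subset.Properties using (_∈?_)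
open import Data.List using (List; length; filter; allFin; map; foldr; sum; upTo)
open import Relation.Binary.PropositionalEquality using (_≡_)
open import Relation.Nullary.Decidable using (_×-dec_)
open import Data.Fin using (_≟_)
open import Data.Product using (_×_)

-- A hypergraph on vertex set V = Fin n with a finite multiset of m edges,
-- represented as an indexed family of edges (repetitions allowed).
record Hypergraph (n m : ℕ) : Set where
  constructor hypergraph
  field
    edge : Fin m → Subset n

open Hypergraph public

Uniform : ∀ {n m} → ℕ → Hypergraph n m → Set
Uniform {m = m} r H = (e : Fin m) → ∣ edge H e ∣ ≡ r

degree : ∀ {n m} → Hypergraph n m → Fin n → ℕ
degree {m = m} H v = length (filter (λ e → v ∈? edge H e) (allFin m))

-- maximum degree (0 if there are no vertices)
maxDegree : ∀ {n m} → Hypergraph n m → ℕ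
maxDegree {n = n} H = foldr _⊔_ 0 (map (degree H) (allFin n))

-- A partition of E into k (possibly empty, pairwise disjoint) edge sets
-- M_1,…,M_k is a map c : Fin m → Fin k, with M_i = c⁻¹(i).
-- Number of edges of class i containing v:
classDegree : ∀ {n m k} → Hypergraph n m → (Fin m → Fin k) → Fin k → Fin n → ℕ
classDegree {m = m} H c i v =
  length (filter (λ e → (c e ≟ i) ×-dec (v ∈? edge H e)) (allFin m))

AllShallow : ∀ {n m k} → ℕ → Hypergraph n m → (Fin m → Fin k) → Set
AllShallow {n} {m} {k} t H c = (i : Fin k) (v : Fin n) → classDegree H c i v ≤ t

-- Euler's number e is the supremum of the partial sums S_N = Σ_{j=0}^{N} 1/j!.
-- eNum N = S_N · N!  (a natural number):  eNum 0 = 1,  eNum (N+1) = (N+1)·eNum N + 1.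
eNum : ℕ → ℕ
eNum zero    = 1
eNum (suc N) = suc N * eNum N + 1

-- e · b ≤ a  (for natural numbers a, b), i.e. b · S_N ≤ a for every N,
-- written with denominators cleared: b · eNum N ≤ a · N!.
e*_≤_ : ℕ → ℕ → Set
e* b ≤ a = (N : ℕ) → b * eNum N ≤ a * (N !)

module Submission where

-- Colour the edges with k colours. For every vertex v and every set S of t + 1 edges through v,
-- let A_S be the event that S is monochromatic; a colouring avoiding all A_S partitions E into
-- k t-shallow classes. Each A_S has probability k^(-t) and is independent of the events whose
-- edge sets are disjoint from S, and at most D = (t + 1) r C(Δ, t) ≤ (t + 1) r Δ^t / t! events
-- (A_S included) meet S. The hypothesis thus gives e D ≤ k^t, and since (1 + 1/D)^D ≤ e this is
-- the condition of the symmetric local lemma. Probabilities are replaced throughout by numbers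
-- of colourings, and the local lemma is proved in the form
--   (D + 1) · #{c avoids T and satisfies A_i} ≤ #{c avoids T}   (A_i ∉ T)
-- by induction on |T|, removing first the events of T that meet A_i.

open import Defs
open import Data.Nat using (ℕ; _*_; _^_; _≤_; _+_; _!)
open import Data.Fin using (Fin)
open import Data.Product using (Σ)

open import Algebra.Bundles using (CommutativeMonoid)
open import Data.Bool using (Bool; true; false; _∧_; _∨_; not; if_then_else_)
open import Data.Bool.Properties
  using (∧-comm; ∧-zeroʳ; ∧-identityʳ; ∧-conicalˡ; ∧-conicalʳ; ∧-distribʳ-∨; ∧-commutativeMonoid; ⇔→≡)
open import Data.Empty using (⊥; ⊥-elim)
open import Data.Fin using (zero; suc; _≟_; toℕ; fromℕ<)
open import Data.Fin.Properties using (toℕ<n)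
open import Data.Fin.Subset using (Subset)
import Data.Fin.Subset as Subset
import Data.Fin.Subset.Properties as Subset
open import Data.List using (List; []; _∷_; [_]; _++_; map; concat; length; lookup; tabulate; filter; foldr)
open import Data.List.Membership.Propositional.Properties using (∈-lookup)
open import Data.List.Properties using (length-++; length-map; map-tabulate)
open import Data.List.Relation.Unary.All as All using (All)
import Data.List.Relation.Unary.All.Properties as All
open import Data.List.Relation.Unary.Any as Any using (Any; here)
import Data.List.Relation.Unary.Any.Properties as Any
open import Data.Nat
  using (zero; suc; pred; _⊔_; _∸_; _<_; _≤?_; z≤n; s≤s; s≤s⁻¹; _≤′_; ≤′-refl; ≤′-step; >-nonZero; >-nonZero⁻¹)
open import Data.Nat.Combinatorics using (_C_; nCk≡nC[n∸k]) renaming (nCk+nC[k+1]≡[n+1]C[k+1] to pascal)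
open import Data.Nat.Properties hiding (_≟_)
open import Data.Nat.Tactic.RingSolver using (solve-∀)
open import Data.Product using (_,_; proj₁; proj₂)
open import Data.Vec using () renaming ([] to []ᵛ; _∷_ to _∷ᵛ_)
import Data.Vec.Functional as Vector
open import Function using (_∘_; case_of_)
open import Function.Bundles using (mk⇔)
open import Relation.Binary.PropositionalEquality hiding ([_])
open import Relation.Nullary using (does; yes; no)
open import Relation.Nullary.Decidable using (dec-true; dec-false; _×-dec_)
open import Relation.Unary using (Decidable)

open import Algebra.Properties.CommutativeSemigroup +-commutativeSemigroup
  using () renaming (interchange to +-interchange)
open import Algebra.Properties.CommutativeSemigroup *-commutativeSemigroup
  using () renaming (x∙yz≈y∙xz to *-leftSwap)
open import Algebra.Properties.CommutativeSemigroup (CommutativeMonoid.commutativeSemigroup ∧-commutativeMonoid)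
  using () renaming (xy∙z≈xz∙y to ∧-rightSwap)

private
  variable
    A : Set
    m : ℕ

_⊆_ : (A → Bool) → (A → Bool) → Set
P ⊆ Q = ∀ x → P x ≡ true → Q x ≡ true

_∩_ : (A → Bool) → (A → Bool) → A → Bool
(P ∩ Q) x = P x ∧ Q x

_─_ : (A → Bool) → (A → Bool) → A → Bool
(P ─ Q) x = P x ∧ not (Q x)

⁅_⁆ : Fin m → Fin m → Bool
⁅ j ⁆ i = does (i ≟ j)

⁅⁆-self : (j : Fin m) → ⁅ j ⁆ j ≡ true
⁅⁆-self j = dec-true (j ≟ j) refl

⁅⁆-≢ : {i j : Fin m} → i ≢ j → ⁅ j ⁆ i ≡ false
⁅⁆-≢ {i = i} {j} i≢j = dec-false (i ≟ j) i≢j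

─-absorb : (P Q : A → Bool) {x : A} → Q x ≡ true → (P ─ Q) x ≡ false
─-absorb P Q {x} Qx = trans (cong (λ b → P x ∧ not b) Qx) (∧-zeroʳ (P x))

─⁅⁆-≢ : (T : Fin m → Bool) {i j : Fin m} → i ≢ j → (T ─ ⁅ j ⁆) i ≡ T i
─⁅⁆-≢ T {i} i≢j = trans (cong (λ b → T i ∧ not b) (⁅⁆-≢ i≢j)) (∧-identityʳ (T i))

∧-true⁺ : ∀ {a b} → a ≡ true → b ≡ true → a ∧ b ≡ true
∧-true⁺ refl refl = refl

∨-true⁺ˡ : ∀ {a b} → a ≡ true → a ∨ b ≡ true
∨-true⁺ˡ refl = refl

∨-true⁺ʳ : ∀ {a b} → b ≡ true → a ∨ b ≡ true
∨-true⁺ʳ {true}  _ = refl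
∨-true⁺ʳ {false} p = p

not-true⁻ : ∀ {a} → not a ≡ true → a ≡ false
not-true⁻ {false} _ = refl

true≢false : ∀ {a} → a ≡ true → a ≡ false → ⊥
true≢false refl ()

indicator : Bool → ℕ
indicator true  = 1
indicator false = 0

∑ : ∀ m → (Fin m → ℕ) → ℕ
∑ zero    f = 0
∑ (suc m) f = f zero + ∑ m (f ∘ suc)

∑-cong : ∀ m {f g : Fin m → ℕ} → (∀ i → f i ≡ g i) → ∑ m f ≡ ∑ m g
∑-cong zero    f≡g = refl
∑-cong (suc m) f≡g = cong₂ _+_ (f≡g zero) (∑-cong m (f≡g ∘ suc))

∑-mono-≤ : ∀ m {f g : Fin m → ℕ} → (∀ i → f i ≤ g i) → ∑ m f ≤ ∑ m g
∑-mono-≤ zero    f≤g = z≤n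
∑-mono-≤ (suc m) f≤g = +-mono-≤ (f≤g zero) (∑-mono-≤ m (f≤g ∘ suc))

∑-distrib-+ : ∀ m (f g : Fin m → ℕ) → ∑ m (λ i → f i + g i) ≡ ∑ m f + ∑ m g
∑-distrib-+ zero    f g = refl
∑-distrib-+ (suc m) f g = begin
  f zero + g zero + ∑ m (λ i → f (suc i) + g (suc i))
    ≡⟨ cong (f zero + g zero +_) (∑-distrib-+ m (f ∘ suc) (g ∘ suc)) ⟩
  f zero + g zero + (∑ m (f ∘ suc) + ∑ m (g ∘ suc))
    ≡⟨ +-interchange (f zero) (g zero) _ _ ⟩
  f zero + ∑ m (f ∘ suc) + (g zero + ∑ m (g ∘ suc)) ∎
  where open ≡-Reasoning

∑-distribˡ-* : ∀ m c (f : Fin m → ℕ) → c * ∑ m f ≡ ∑ m (λ i → c * f i)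
∑-distribˡ-* zero    c f = *-zeroʳ c
∑-distribˡ-* (suc m) c f =
  trans (*-distribˡ-+ c (f zero) _) (cong (c * f zero +_) (∑-distribˡ-* m c (f ∘ suc)))

∑-distribʳ-* : ∀ m c (f : Fin m → ℕ) → ∑ m f * c ≡ ∑ m (λ i → f i * c)
∑-distribʳ-* m c f =
  trans (*-comm (∑ m f) c) (trans (∑-distribˡ-* m c f) (∑-cong m (λ i → *-comm c (f i))))

∑-const : ∀ m c → ∑ m (λ _ → c) ≡ m * c
∑-const zero    c = refl
∑-const (suc m) c = cong (c +_) (∑-const m c)

∑-zero : ∀ m → ∑ m (λ _ → 0) ≡ 0
∑-zero m = trans (∑-const m 0) (*-zeroʳ m)

∑-pos : ∀ m (f : Fin m → ℕ) → 0 < ∑ m f → Σ (Fin m) (λ i → 0 < f i)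
∑-pos (suc m) f ∑>0 with f zero in eq
... | suc _ = zero , subst (0 <_) (sym eq) (s≤s z≤n)
... | zero  with ∑-pos m (f ∘ suc) ∑>0
...   | i , fi>0 = suc i , fi>0

∑-⁅⁆ : ∀ m (a : Fin m) c → ∑ m (λ i → if ⁅ a ⁆ i then c else 0) ≡ c
∑-⁅⁆ (suc m) zero    c = trans (cong (c +_) (∑-zero m)) (+-identityʳ c)
∑-⁅⁆ (suc m) (suc a) c = ∑-⁅⁆ m a c

indicator-mono : ∀ {a b} → (a ≡ true → b ≡ true) → indicator a ≤ indicator b
indicator-mono {false} _   = z≤n
indicator-mono {true}  a⇒b rewrite a⇒b refl = ≤-refl

indicator-≤1 : ∀ a → indicator a ≤ 1
indicator-≤1 true  = ≤-refl
indicator-≤1 false = z≤n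

indicator-pos : ∀ {a} → 0 < indicator a → a ≡ true
indicator-pos {true} _ = refl

indicator-∨ : ∀ a b → indicator (a ∨ b) ≤ indicator a + indicator b
indicator-∨ false b = ≤-refl
indicator-∨ true  b = s≤s z≤n

indicator-split : ∀ a b → indicator a ≡ indicator (a ∧ b) + indicator (a ∧ not b)
indicator-split false b     = refl
indicator-split true  false = refl
indicator-split true  true  = refl

count : (Fin m → Bool) → ℕ
count {m} P = ∑ m (indicator ∘ P)

count-cong : {P Q : Fin m → Bool} → (∀ i → P i ≡ Q i) → count P ≡ count Q
count-cong {m} P≡Q = ∑-cong m (cong indicator ∘ P≡Q)

count-mono : {P Q : Fin m → Bool} → P ⊆ Q → count P ≤ count Q
count-mono {m} P⊆Q = ∑-mono-≤ m (λ i → indicator-mono (P⊆Q i))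

count-≤ : (P : Fin m → Bool) → count P ≤ m
count-≤ {zero}  P = z≤n
count-≤ {suc m} P = +-mono-≤ (indicator-≤1 (P zero)) (count-≤ (P ∘ suc))

count≡0⇒false : (P : Fin m → Bool) → count P ≡ 0 → ∀ i → P i ≡ false
count≡0⇒false P #P≡0 zero    with P zero
... | false = refl
count≡0⇒false P #P≡0 (suc i) with P zero
... | false = count≡0⇒false (P ∘ suc) #P≡0 i

count-pos : (P : Fin m → Bool) → 0 < count P → Σ (Fin m) (λ i → P i ≡ true)
count-pos {m} P #P>0 with ∑-pos m _ #P>0
... | i , Pi>0 = i , indicator-pos Pi>0

count-─⁅⁆ : (T : Fin m → Bool) (j : Fin m) → T j ≡ true → suc (count (T ─ ⁅ j ⁆)) ≡ count T
count-─⁅⁆ T zero    Tj rewrite Tj = cong suc (count-cong (λ i → ∧-identityʳ (T (suc i))))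
count-─⁅⁆ T (suc j) Tj = begin
  suc (indicator (T zero ∧ true) + count ((T ∘ suc) ─ ⁅ j ⁆))
    ≡⟨ cong (λ b → suc (indicator b + count ((T ∘ suc) ─ ⁅ j ⁆))) (∧-identityʳ (T zero)) ⟩
  suc (indicator (T zero) + count ((T ∘ suc) ─ ⁅ j ⁆))
    ≡⟨ sym (+-suc (indicator (T zero)) _) ⟩
  indicator (T zero) + suc (count ((T ∘ suc) ─ ⁅ j ⁆))
    ≡⟨ cong (indicator (T zero) +_) (count-─⁅⁆ (T ∘ suc) j Tj) ⟩
  indicator (T zero) + count (T ∘ suc) ∎
  where open ≡-Reasoning

count-< : {P Q : Fin m → Bool} (i : Fin m) → P ⊆ Q → Q i ≡ true → P i ≡ false → count P < count Q
count-< {P = P} {Q} i P⊆Q Qi Pi = begin-strict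
  count P               <⟨ s≤s (count-mono P⊆Q─i) ⟩
  suc (count (Q ─ ⁅ i ⁆)) ≡⟨ count-─⁅⁆ Q i Qi ⟩
  count Q               ∎
  where
  open ≤-Reasoning
  P⊆Q─i : P ⊆ (Q ─ ⁅ i ⁆)
  P⊆Q─i x Px with x ≟ i
  ... | yes refl = ⊥-elim (true≢false Px Pi)
  ... | no  _    = ∧-true⁺ (P⊆Q x Px) refl

allᵇ : (Fin m → Bool) → Bool
allᵇ {zero}  P = true
allᵇ {suc m} P = P zero ∧ allᵇ (P ∘ suc)

anyᵇ : (Fin m → Bool) → Bool
anyᵇ {zero}  P = false
anyᵇ {suc m} P = P zero ∨ anyᵇ (P ∘ suc)

allᵇ-true⁻ : (P : Fin m → Bool) → allᵇ P ≡ true → ∀ i → P i ≡ true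
allᵇ-true⁻ P all zero    = ∧-conicalˡ _ _ all
allᵇ-true⁻ P all (suc i) = allᵇ-true⁻ (P ∘ suc) (∧-conicalʳ _ _ all) i

allᵇ-true⁺ : (P : Fin m → Bool) → (∀ i → P i ≡ true) → allᵇ P ≡ true
allᵇ-true⁺ {zero}  P all = refl
allᵇ-true⁺ {suc m} P all = ∧-true⁺ (all zero) (allᵇ-true⁺ (P ∘ suc) (all ∘ suc))

allᵇ-cong : {P Q : Fin m → Bool} → (∀ i → P i ≡ Q i) → allᵇ P ≡ allᵇ Q
allᵇ-cong {zero}  P≡Q = refl
allᵇ-cong {suc m} P≡Q = cong₂ _∧_ (P≡Q zero) (allᵇ-cong (P≡Q ∘ suc))

anyᵇ-true⁺ : (P : Fin m → Bool) (i : Fin m) → P i ≡ true → anyᵇ P ≡ true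
anyᵇ-true⁺ P zero    Pi = ∨-true⁺ˡ Pi
anyᵇ-true⁺ P (suc i) Pi = ∨-true⁺ʳ {P zero} (anyᵇ-true⁺ (P ∘ suc) i Pi)

anyᵇ-false⁻ : (P : Fin m → Bool) → anyᵇ P ≡ false → ∀ i → P i ≡ false
anyᵇ-false⁻ P none i with P i in Pi
... | false = refl
... | true  = ⊥-elim (true≢false (anyᵇ-true⁺ P i Pi) none)

anyᵇ-cong : {P Q : Fin m → Bool} → (∀ i → P i ≡ Q i) → anyᵇ P ≡ anyᵇ Q
anyᵇ-cong {zero}  P≡Q = refl
anyᵇ-cong {suc m} P≡Q = cong₂ _∨_ (P≡Q zero) (anyᵇ-cong (P≡Q ∘ suc))

anyᵇ-∧ : (P : Fin m → Bool) (b : Bool) → anyᵇ P ∧ b ≡ anyᵇ (λ i → P i ∧ b)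
anyᵇ-∧ {zero}  P b = refl
anyᵇ-∧ {suc m} P b = trans (∧-distribʳ-∨ b (P zero) _) (cong (P zero ∧ b ∨_) (anyᵇ-∧ (P ∘ suc) b))

count-anyᵇ : ∀ n (R : Fin n → Fin m → Bool) → count (λ j → anyᵇ (λ e → R e j)) ≤ ∑ n (λ e → count (R e))
count-anyᵇ {m} zero    R = ≤-reflexive (∑-zero m)
count-anyᵇ {m} (suc n) R = begin
  count (λ j → R zero j ∨ anyᵇ (λ e → R (suc e) j))
    ≤⟨ ∑-mono-≤ m (λ j → indicator-∨ (R zero j) _) ⟩
  ∑ m (λ j → indicator (R zero j) + indicator (anyᵇ (λ e → R (suc e) j)))
    ≡⟨ ∑-distrib-+ m _ _ ⟩
  count (R zero) + count (λ j → anyᵇ (λ e → R (suc e) j))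
    ≤⟨ +-monoʳ-≤ (count (R zero)) (count-anyᵇ n (R ∘ suc)) ⟩
  count (R zero) + ∑ n (λ e → count (R (suc e))) ∎
  where open ≤-Reasoning

-- Binomial coefficients and the number e

C-mono-suc : ∀ n k → n C k ≤ suc n C k
C-mono-suc n zero    = ≤-refl
C-mono-suc n (suc k) = ≤-trans (m≤n+m _ _) (≤-reflexive (pascal n k))

C-monoˡ-≤ : ∀ {n n′} k → n ≤ n′ → n C k ≤ n′ C k
C-monoˡ-≤ {n} k n≤n′ = go (≤⇒≤′ n≤n′)
  where
  go : ∀ {n′} → n ≤′ n′ → n C k ≤ n′ C k
  go ≤′-refl        = ≤-refl
  go (≤′-step n≤n′) = ≤-trans (go n≤n′) (C-mono-suc _ k)

C-pos : ∀ n k → k ≤ n → 0 < n C k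
C-pos n       zero    _         = s≤s z≤n
C-pos (suc n) (suc k) (s≤s k≤n) = ≤-trans (C-pos n k k≤n) (≤-trans (m≤m+n _ _) (≤-reflexive (pascal n k)))

-- Bernoulli's inequality (1 + 1/n)^(k+1) ≥ 1 + (k+1)/n, multiplied by n^(k+1).
bernoulli : ∀ n k → n ^ suc k + suc k * n ^ k ≤ suc n ^ suc k
bernoulli n zero    = ≤-reflexive (identity n)
  where
  identity : ∀ n → n * 1 + 1 * 1 ≡ suc n * 1
  identity = solve-∀
bernoulli n (suc k) = begin
  n ^ suc (suc k) + suc (suc k) * n ^ suc k
    ≤⟨ m≤m+n _ (suc k * n ^ k) ⟩
  n ^ suc (suc k) + suc (suc k) * n ^ suc k + suc k * n ^ k
    ≡⟨ identity n (n ^ k) k ⟩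
  suc n * (n ^ suc k + suc k * n ^ k)
    ≤⟨ *-monoʳ-≤ (suc n) (bernoulli n k) ⟩
  suc n ^ suc (suc k) ∎
  where
  open ≤-Reasoning
  identity : ∀ n a k → n * (n * a) + suc (suc k) * (n * a) + suc k * a ≡ suc n * (n * a + suc k * a)
  identity = solve-∀

C*!≤^ : ∀ n k → (n C k) * k ! ≤ n ^ k
C*!≤^ n       zero    = ≤-refl
C*!≤^ zero    (suc k) = z≤n
C*!≤^ (suc n) (suc k) = begin
  (suc n C suc k) * (suc k * k !)
    ≡⟨ cong (_* (suc k * k !)) (sym (pascal n k)) ⟩
  (n C k + n C suc k) * (suc k * k !)
    ≡⟨ identity (n C k) (n C suc k) (suc k) (k !) ⟩
  suc k * ((n C k) * k !) + (n C suc k) * (suc k * k !)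
    ≤⟨ +-mono-≤ (*-monoʳ-≤ (suc k) (C*!≤^ n k)) (C*!≤^ n (suc k)) ⟩
  suc k * n ^ k + n ^ suc k
    ≡⟨ +-comm (suc k * n ^ k) _ ⟩
  n ^ suc k + suc k * n ^ k
    ≤⟨ bernoulli n k ⟩
  suc n ^ suc k ∎
  where
  open ≤-Reasoning
  identity : ∀ a b c d → (a + b) * (c * d) ≡ c * (a * d) + b * (c * d)
  identity = solve-∀

binomial-theorem : ∀ j x L → j < L → suc x ^ j ≡ ∑ L (λ i → (j C toℕ i) * x ^ toℕ i)
binomial-theorem zero    x (suc L) _         = sym (cong suc (∑-zero L))
binomial-theorem (suc j) x (suc L) (s≤s j<L) = sym (begin
  1 + ∑ L (λ i → (suc j C suc (toℕ i)) * x ^ suc (toℕ i))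
    ≡⟨ cong suc (∑-cong L (λ i → cong (_* x ^ suc (toℕ i)) (sym (pascal j (toℕ i))))) ⟩
  1 + ∑ L (λ i → (j C toℕ i + j C suc (toℕ i)) * (x * x ^ toℕ i))
    ≡⟨ cong suc (∑-cong L (λ i → identity (j C toℕ i) (j C suc (toℕ i)) x (x ^ toℕ i))) ⟩
  1 + ∑ L (λ i → x * ((j C toℕ i) * x ^ toℕ i) + (j C suc (toℕ i)) * x ^ suc (toℕ i))
    ≡⟨ cong suc (∑-distrib-+ L _ _) ⟩
  1 + (∑ L (λ i → x * ((j C toℕ i) * x ^ toℕ i)) + R)
    ≡⟨ cong (λ s → 1 + (s + R)) (sym (∑-distribˡ-* L x _)) ⟩
  1 + (x * E + R)
    ≡⟨ cong suc (+-comm (x * E) _) ⟩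
  1 + R + x * E
    ≡⟨ cong (_+ x * E) (sym (binomial-theorem j x (suc L) (m≤n⇒m≤1+n j<L))) ⟩
  suc x ^ j + x * E
    ≡⟨ cong (λ e → suc x ^ j + x * e) (sym (binomial-theorem j x L j<L)) ⟩
  suc x ^ suc j ∎)
  where
  open ≡-Reasoning
  E R : ℕ
  E = ∑ L (λ i → (j C toℕ i) * x ^ toℕ i)
  R = ∑ L (λ i → (j C suc (toℕ i)) * x ^ suc (toℕ i))
  identity : ∀ a b x y → (a + b) * (x * y) ≡ x * (a * y) + b * (x * y)
  identity = solve-∀

fallingFactorial : ℕ → ℕ → ℕ
fallingFactorial n       zero    = 1
fallingFactorial zero    (suc i) = 0
fallingFactorial (suc n) (suc i) = suc n * fallingFactorial n i

fallingFactorial*! : ∀ i q → fallingFactorial (i + q) i * q ! ≡ (i + q) !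
fallingFactorial*! zero    q = *-identityˡ (q !)
fallingFactorial*! (suc i) q =
  trans (*-assoc (suc (i + q)) (fallingFactorial (i + q) i) (q !))
        (cong (suc (i + q) *_) (fallingFactorial*! i q))

eNum≡∑fallingFactorial : ∀ n L → n < L → eNum n ≡ ∑ L (λ i → fallingFactorial n (toℕ i))
eNum≡∑fallingFactorial zero    (suc L) _         = sym (cong suc (∑-zero L))
eNum≡∑fallingFactorial (suc n) (suc L) (s≤s n<L) = begin
  suc n * eNum n + 1
    ≡⟨ +-comm (suc n * eNum n) 1 ⟩
  1 + suc n * eNum n
    ≡⟨ cong (λ e → 1 + suc n * e) (eNum≡∑fallingFactorial n L n<L) ⟩
  1 + suc n * ∑ L (λ i → fallingFactorial n (toℕ i))
    ≡⟨ cong suc (∑-distribˡ-* L (suc n) (λ i → fallingFactorial n (toℕ i))) ⟩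
  1 + ∑ L (λ i → suc n * fallingFactorial n (toℕ i)) ∎
  where open ≡-Reasoning

-- Termwise comparison of  (n+1)^n · n! = ∑_i C(n,i) n^i n!  with  eNum n · n^n = ∑_i n!/(n-i)! · n^n.
C*^*!≤fallingFactorial*^ : ∀ n i → i ≤ n → (n C i) * n ^ i * n ! ≤ fallingFactorial n i * n ^ n
C*^*!≤fallingFactorial*^ n i i≤n = subst (λ N → (N C i) * N ^ i * N ! ≤ fallingFactorial N i * N ^ N)
  (m+[n∸m]≡n i≤n) (split i (n ∸ i))
  where
  split : ∀ i q → ((i + q) C i) * (i + q) ^ i * (i + q) ! ≤ fallingFactorial (i + q) i * (i + q) ^ (i + q)
  split i q = begin
    (N C i) * N ^ i * N !
      ≡⟨ cong ((N C i) * N ^ i *_) (sym (fallingFactorial*! i q)) ⟩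
    (N C i) * N ^ i * (F * q !)
      ≡⟨ cong (λ c → c * N ^ i * (F * q !)) C-sym ⟩
    (N C q) * N ^ i * (F * q !)
      ≡⟨ identity (N C q) (N ^ i) F (q !) ⟩
    F * N ^ i * ((N C q) * q !)
      ≤⟨ *-monoʳ-≤ (F * N ^ i) (C*!≤^ N q) ⟩
    F * N ^ i * N ^ q
      ≡⟨ *-assoc F _ _ ⟩
    F * (N ^ i * N ^ q)
      ≡⟨ cong (F *_) (sym (^-distribˡ-+-* N i q)) ⟩
    F * N ^ (i + q) ∎
    where
    open ≤-Reasoning
    N F : ℕ
    N = i + q
    F = fallingFactorial N i
    C-sym : N C i ≡ N C q
    C-sym = trans (nCk≡nC[n∸k] (m≤m+n i q)) (cong (N C_) (m+n∸m≡n i q))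
    identity : ∀ a b c d → a * b * (c * d) ≡ c * b * (a * d)
    identity = solve-∀

-- (1 + 1/n)^n ≤ e, with denominators cleared.
suc^*!≤eNum*^ : ∀ n → suc n ^ n * n ! ≤ eNum n * n ^ n
suc^*!≤eNum*^ n = begin
  suc n ^ n * n !
    ≡⟨ cong (_* n !) (binomial-theorem n n (suc n) ≤-refl) ⟩
  ∑ (suc n) (λ i → (n C toℕ i) * n ^ toℕ i) * n !
    ≡⟨ ∑-distribʳ-* (suc n) (n !) (λ i → (n C toℕ i) * n ^ toℕ i) ⟩
  ∑ (suc n) (λ i → (n C toℕ i) * n ^ toℕ i * n !)
    ≤⟨ ∑-mono-≤ (suc n) (λ i → C*^*!≤fallingFactorial*^ n (toℕ i) (s≤s⁻¹ (toℕ<n i))) ⟩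
  ∑ (suc n) (λ i → fallingFactorial n (toℕ i) * n ^ n)
    ≡⟨ sym (∑-distribʳ-* (suc n) (n ^ n) (λ i → fallingFactorial n (toℕ i))) ⟩
  ∑ (suc n) (λ i → fallingFactorial n (toℕ i)) * n ^ n
    ≡⟨ cong (_* n ^ n) (sym (eNum≡∑fallingFactorial n (suc n) ≤-refl)) ⟩
  eNum n * n ^ n ∎
  where open ≤-Reasoning

e*≤⇒symmetricCondition : ∀ K f κ a → suc K * f ≤ a → e* a ≤ (f * κ) → 0 < f → suc (suc K) ^ suc K ≤ κ * suc K ^ K
e*≤⇒symmetricCondition K f κ a Df≤a e*a≤fκ f>0 =
  *-cancelˡ-≤ D (*-cancelˡ-≤ (f * D !) {{>-nonZero (*-mono-≤ f>0 (1≤n! D))}} (begin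
    f * D ! * (D * suc D ^ D)      ≡⟨ identity₁ f (D !) D (suc D ^ D) ⟩
    D * f * (suc D ^ D * D !)      ≤⟨ *-monoʳ-≤ (D * f) (suc^*!≤eNum*^ D) ⟩
    D * f * (eNum D * D ^ D)       ≡⟨ sym (*-assoc (D * f) (eNum D) (D ^ D)) ⟩
    D * f * eNum D * D ^ D         ≤⟨ *-monoˡ-≤ (D ^ D) (*-monoˡ-≤ (eNum D) Df≤a) ⟩
    a * eNum D * D ^ D             ≤⟨ *-monoˡ-≤ (D ^ D) (e*a≤fκ D) ⟩
    f * κ * D ! * (D * D ^ K)      ≡⟨ identity₂ f κ (D !) D (D ^ K) ⟩
    f * D ! * (D * (κ * D ^ K))    ∎))
  where
  open ≤-Reasoning
  D : ℕ
  D = suc K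
  identity₁ : ∀ a b c d → a * b * (c * d) ≡ c * a * (d * b)
  identity₁ = solve-∀
  identity₂ : ∀ a b c d e → a * b * c * (d * e) ≡ a * c * (d * (b * e))
  identity₂ = solve-∀

countᴸ : (A → Bool) → List A → ℕ
countᴸ P []       = 0
countᴸ P (x ∷ xs) = indicator (P x) + countᴸ P xs

countᴸ-++ : (P : A → Bool) (xs ys : List A) → countᴸ P (xs ++ ys) ≡ countᴸ P xs + countᴸ P ys
countᴸ-++ P []       ys = refl
countᴸ-++ P (x ∷ xs) ys =
  trans (cong (indicator (P x) +_) (countᴸ-++ P xs ys)) (sym (+-assoc (indicator (P x)) _ _))

countᴸ-map : ∀ {B : Set} (P : B → Bool) (f : A → B) xs → countᴸ P (map f xs) ≡ countᴸ (P ∘ f) xs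
countᴸ-map P f []       = refl
countᴸ-map P f (x ∷ xs) = cong (indicator (P (f x)) +_) (countᴸ-map P f xs)

countᴸ-false : (xs : List A) → countᴸ (λ _ → false) xs ≡ 0
countᴸ-false []       = refl
countᴸ-false (x ∷ xs) = countᴸ-false xs

countᴸ-true : (xs : List A) → countᴸ (λ _ → true) xs ≡ length xs
countᴸ-true []       = refl
countᴸ-true (x ∷ xs) = cong suc (countᴸ-true xs)

count-lookup : (P : A → Bool) (xs : List A) → count (P ∘ lookup xs) ≡ countᴸ P xs
count-lookup P []       = refl
count-lookup P (x ∷ xs) = cong (indicator (P x) +_) (count-lookup P xs)

countᴸ-concat-tabulate : ∀ n (P : A → Bool) (xss : Fin n → List A) →
                         countᴸ P (concat (tabulate xss)) ≡ ∑ n (countᴸ P ∘ xss)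
countᴸ-concat-tabulate zero    P xss = refl
countᴸ-concat-tabulate (suc n) P xss =
  trans (countᴸ-++ P (xss zero) _) (cong (countᴸ P (xss zero) +_) (countᴸ-concat-tabulate n P (xss ∘ suc)))

subsetsOfSize : ℕ → (Fin m → Bool) → List (Fin m → Bool)
subsetsOfSize {zero}  zero    L = [ (λ ()) ]
subsetsOfSize {zero}  (suc s) L = []
subsetsOfSize {suc m} zero    L = map (false Vector.∷_) (subsetsOfSize zero (L ∘ suc))
subsetsOfSize {suc m} (suc s) L =
  (if L zero then map (true Vector.∷_) (subsetsOfSize s (L ∘ suc)) else [])
  ++ map (false Vector.∷_) (subsetsOfSize (suc s) (L ∘ suc))

subsetsOfSize-count : ∀ s (L : Fin m → Bool) → All (λ S → count S ≡ s) (subsetsOfSize s L)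
subsetsOfSize-count {zero}  zero    L = refl All.∷ All.[]
subsetsOfSize-count {zero}  (suc s) L = All.[]
subsetsOfSize-count {suc m} zero    L = All.map⁺ (subsetsOfSize-count zero (L ∘ suc))
subsetsOfSize-count {suc m} (suc s) L with L zero
... | true  = All.++⁺ (All.map⁺ (All.map (cong suc) (subsetsOfSize-count s (L ∘ suc))))
                      (All.map⁺ (subsetsOfSize-count (suc s) (L ∘ suc)))
... | false = All.map⁺ (subsetsOfSize-count (suc s) (L ∘ suc))

length-subsetsOfSize : ∀ s (L : Fin m → Bool) → length (subsetsOfSize s L) ≡ count L C s
length-subsetsOfSize {zero}  zero    L = refl
length-subsetsOfSize {zero}  (suc s) L = refl
length-subsetsOfSize {suc m} zero    L =
  trans (length-map _ (subsetsOfSize zero (L ∘ suc))) (length-subsetsOfSize zero (L ∘ suc))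
length-subsetsOfSize {suc m} (suc s) L with L zero
... | true  = begin
  length (map (true Vector.∷_) With ++ map (false Vector.∷_) Without)
    ≡⟨ length-++ (map (true Vector.∷_) With) ⟩
  length (map (true Vector.∷_) With) + length (map (false Vector.∷_) Without)
    ≡⟨ cong₂ _+_ (length-map _ With) (length-map _ Without) ⟩
  length With + length Without
    ≡⟨ cong₂ _+_ (length-subsetsOfSize s (L ∘ suc)) (length-subsetsOfSize (suc s) (L ∘ suc)) ⟩
  count (L ∘ suc) C s + count (L ∘ suc) C suc s
    ≡⟨ pascal (count (L ∘ suc)) s ⟩
  suc (count (L ∘ suc)) C suc s ∎
  where
  open ≡-Reasoning
  With Without : List (Fin m → Bool)
  With    = subsetsOfSize s (L ∘ suc)
  Without = subsetsOfSize (suc s) (L ∘ suc)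
... | false =
  trans (length-map _ (subsetsOfSize (suc s) (L ∘ suc))) (length-subsetsOfSize (suc s) (L ∘ suc))

∌-subsetsOfSize-zero : (L : Fin m → Bool) (e : Fin m) → countᴸ (λ S → S e) (subsetsOfSize zero L) ≡ 0
∌-subsetsOfSize-zero L zero    =
  trans (countᴸ-map _ _ (subsetsOfSize zero (L ∘ suc))) (countᴸ-false (subsetsOfSize zero (L ∘ suc)))
∌-subsetsOfSize-zero L (suc e) =
  trans (countᴸ-map _ _ (subsetsOfSize zero (L ∘ suc))) (∌-subsetsOfSize-zero (L ∘ suc) e)

∋-subsetsOfSize-suc : ∀ s (L : Fin m → Bool) (e : Fin m) →
                      countᴸ (λ S → S e) (subsetsOfSize (suc s) L) ≤ indicator (L e) * (count L C s)
∋-subsetsOfSize-suc {suc m} s L zero with L zero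
... | true  = begin
  countᴸ (λ S → S zero) (map (true Vector.∷_) With ++ map (false Vector.∷_) Without)
    ≡⟨ countᴸ-++ _ (map (true Vector.∷_) With) _ ⟩
  countᴸ (λ S → S zero) (map (true Vector.∷_) With) + countᴸ (λ S → S zero) (map (false Vector.∷_) Without)
    ≡⟨ cong₂ _+_ (countᴸ-map _ _ With) (countᴸ-map _ _ Without) ⟩
  countᴸ (λ _ → true) With + countᴸ (λ _ → false) Without
    ≡⟨ cong₂ _+_ (trans (countᴸ-true With) (length-subsetsOfSize s (L ∘ suc))) (countᴸ-false Without) ⟩
  count (L ∘ suc) C s + 0
    ≤⟨ +-monoˡ-≤ 0 (C-mono-suc (count (L ∘ suc)) s) ⟩
  suc (count (L ∘ suc)) C s + 0 ∎
  where
  open ≤-Reasoning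
  With Without : List (Fin m → Bool)
  With    = subsetsOfSize s (L ∘ suc)
  Without = subsetsOfSize (suc s) (L ∘ suc)
... | false = ≤-reflexive
  (trans (countᴸ-map _ _ (subsetsOfSize (suc s) (L ∘ suc))) (countᴸ-false (subsetsOfSize (suc s) (L ∘ suc))))
∋-subsetsOfSize-suc {suc m} s L (suc e) with L zero
... | true  = begin
  countᴸ (λ S → S (suc e)) (map (true Vector.∷_) With ++ map (false Vector.∷_) Without)
    ≡⟨ countᴸ-++ _ (map (true Vector.∷_) With) _ ⟩
  countᴸ (λ S → S (suc e)) (map (true Vector.∷_) With) + countᴸ (λ S → S (suc e)) (map (false Vector.∷_) Without)
    ≡⟨ cong₂ _+_ (countᴸ-map _ _ With) (countᴸ-map _ _ Without) ⟩
  countᴸ (λ S → S e) With + countᴸ (λ S → S e) Without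
    ≤⟨ consecutive s ⟩
  indicator (L′ e) * (suc (count L′) C s) ∎
  where
  open ≤-Reasoning
  L′ : Fin m → Bool
  L′ = L ∘ suc
  With Without : List (Fin m → Bool)
  With    = subsetsOfSize s L′
  Without = subsetsOfSize (suc s) L′
  consecutive : ∀ s → countᴸ (λ S → S e) (subsetsOfSize s L′) + countᴸ (λ S → S e) (subsetsOfSize (suc s) L′)
                      ≤ indicator (L′ e) * (suc (count L′) C s)
  consecutive zero     rewrite ∌-subsetsOfSize-zero L′ e = ∋-subsetsOfSize-suc zero L′ e
  consecutive (suc s) = begin
    countᴸ (λ S → S e) (subsetsOfSize (suc s) L′) + countᴸ (λ S → S e) (subsetsOfSize (suc (suc s)) L′)
      ≤⟨ +-mono-≤ (∋-subsetsOfSize-suc s L′ e) (∋-subsetsOfSize-suc (suc s) L′ e) ⟩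
    indicator (L′ e) * (count L′ C s) + indicator (L′ e) * (count L′ C suc s)
      ≡⟨ sym (*-distribˡ-+ (indicator (L′ e)) _ _) ⟩
    indicator (L′ e) * (count L′ C s + count L′ C suc s)
      ≡⟨ cong (indicator (L′ e) *_) (pascal (count L′) s) ⟩
    indicator (L′ e) * (suc (count L′) C suc s) ∎
... | false =
  ≤-trans (≤-reflexive (countᴸ-map _ _ (subsetsOfSize (suc s) (L ∘ suc)))) (∋-subsetsOfSize-suc s (L ∘ suc) e)

∷-⊆ : ∀ {b} {S : Fin m → Bool} {P : Fin (suc m) → Bool} →
      (b ≡ true → P zero ≡ true) → S ⊆ (P ∘ suc) → (b Vector.∷ S) ⊆ P
∷-⊆ b⇒P0 S⊆P zero    = b⇒P0
∷-⊆ b⇒P0 S⊆P (suc i) = S⊆P i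

subsetsOfSize-⊆ : ∀ s (L P : Fin m → Bool) → s ≤ count (L ∩ P) → Any (_⊆ P) (subsetsOfSize s L)
subsetsOfSize-⊆ {zero}  zero    L P _ = here (λ ())
subsetsOfSize-⊆ {suc m} zero    L P _ =
  Any.map⁺ (Any.map (∷-⊆ (λ ())) (subsetsOfSize-⊆ zero (L ∘ suc) (P ∘ suc) z≤n))
subsetsOfSize-⊆ {suc m} (suc s) L P s<∣L∩P∣ with L zero | P zero in P0
... | true  | true  = Any.++⁺ˡ (Any.map⁺ (Any.map (∷-⊆ (λ _ → P0))
                        (subsetsOfSize-⊆ s (L ∘ suc) (P ∘ suc) (s≤s⁻¹ s<∣L∩P∣))))
... | true  | false = Any.++⁺ʳ (map (true Vector.∷_) (subsetsOfSize s (L ∘ suc)))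
                        (Any.map⁺ (Any.map (∷-⊆ (λ ()))
                          (subsetsOfSize-⊆ (suc s) (L ∘ suc) (P ∘ suc) s<∣L∩P∣)))
... | false | _     = Any.map⁺ (Any.map (∷-⊆ (λ ())) (subsetsOfSize-⊆ (suc s) (L ∘ suc) (P ∘ suc) s<∣L∩P∣))

module Colourings (k : ℕ) where

  Colouring : ℕ → Set
  Colouring m = Fin m → Fin k

  # : (Colouring m → Bool) → ℕ
  # {zero}  P = indicator (P (λ ()))
  # {suc m} P = ∑ k (λ x → # (λ c → P (x Vector.∷ c)))

  #-cong : {P Q : Colouring m → Bool} → (∀ c → P c ≡ Q c) → # P ≡ # Q
  #-cong {zero}  P≡Q = cong indicator (P≡Q _)
  #-cong {suc m} P≡Q = ∑-cong k (λ x → #-cong (λ c → P≡Q (x Vector.∷ c)))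

  #-mono : {P Q : Colouring m → Bool} → P ⊆ Q → # P ≤ # Q
  #-mono {zero}  P⊆Q = indicator-mono (P⊆Q _)
  #-mono {suc m} P⊆Q = ∑-mono-≤ k (λ x → #-mono (λ c → P⊆Q (x Vector.∷ c)))

  #-false : # {m} (λ _ → false) ≡ 0
  #-false {zero}  = refl
  #-false {suc m} = trans (∑-cong k (λ _ → #-false {m})) (∑-zero k)

  #-∨ : (P Q : Colouring m → Bool) → # (λ c → P c ∨ Q c) ≤ # P + # Q
  #-∨ {zero}  P Q = indicator-∨ (P _) (Q _)
  #-∨ {suc m} P Q = ≤-trans (∑-mono-≤ k (λ x → #-∨ (P ∘ (x Vector.∷_)) (Q ∘ (x Vector.∷_))))
                            (≤-reflexive (∑-distrib-+ k _ _))

  #-split : (P R : Colouring m → Bool) → # P ≡ # (P ∩ R) + # (P ─ R)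
  #-split {zero}  P R = indicator-split (P _) (R _)
  #-split {suc m} P R =
    trans (∑-cong k (λ x → #-split (P ∘ (x Vector.∷_)) (R ∘ (x Vector.∷_)))) (∑-distrib-+ k _ _)

  #-pos : (P : Colouring m → Bool) → 0 < # P → Σ (Colouring m) (λ c → P c ≡ true)
  #-pos {zero}  P #P>0 = _ , indicator-pos #P>0
  #-pos {suc m} P #P>0 with ∑-pos k _ #P>0
  ... | x , #P[x∷]>0 with #-pos (P ∘ (x Vector.∷_)) #P[x∷]>0
  ...   | c , Pc = (x Vector.∷ c) , Pc

  #-true-pos : 0 < k → 0 < # {m} (λ _ → true)
  #-true-pos {zero}  k>0       = s≤s z≤n
  #-true-pos {suc m} (s≤s k>0) = ≤-trans (#-true-pos {m} (s≤s k>0)) (m≤m+n _ _)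

  #-anyᵇ : ∀ n (R : Fin n → Colouring m → Bool) → # (λ c → anyᵇ (λ a → R a c)) ≤ ∑ n (λ a → # (R a))
  #-anyᵇ {m} zero    R = ≤-reflexive (#-false {m})
  #-anyᵇ (suc n) R =
    ≤-trans (#-∨ (R zero) (λ c → anyᵇ (λ a → R (suc a) c))) (+-monoʳ-≤ (# (R zero)) (#-anyᵇ n (R ∘ suc)))

  #-if : ∀ b (P Q : Colouring m → Bool) → # (λ c → (b ∧ P c) ∧ Q c) ≡ (if b then # (P ∩ Q) else 0)
  #-if true  P Q = refl
  #-if {m} false P Q = #-false {m}

  monochromaticIn : (Fin m → Bool) → Fin k → Colouring m → Bool
  monochromaticIn S a c = allᵇ (λ e → not (S e) ∨ ⁅ a ⁆ (c e))

  monochromatic : (Fin m → Bool) → Colouring m → Bool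
  monochromatic S c = anyᵇ (λ a → monochromaticIn S a c)

  monochromatic-cong : (S : Fin m → Bool) {c c′ : Colouring m} → (∀ e → S e ≡ true → c e ≡ c′ e) →
                       monochromatic S c ≡ monochromatic S c′
  monochromatic-cong S {c} {c′} c≈c′ = anyᵇ-cong (λ a → allᵇ-cong (agree a))
    where
    agree : ∀ a e → (not (S e) ∨ ⁅ a ⁆ (c e)) ≡ (not (S e) ∨ ⁅ a ⁆ (c′ e))
    agree a e with S e in Se
    ... | false = refl
    ... | true  = cong ⁅ a ⁆ (c≈c′ e Se)

  DependsOnlyOutside : (Fin m → Bool) → (Colouring m → Bool) → Set
  DependsOnlyOutside S Q = ∀ c c′ → (∀ e → S e ≡ false → c e ≡ c′ e) → Q c ≡ Q c′

  k^*#monochromaticIn∩≡# : (S : Fin m → Bool) (a : Fin k) (Q : Colouring m → Bool) → DependsOnlyOutside S Q →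
                           k ^ count S * # (monochromaticIn S a ∩ Q) ≡ # Q
  k^*#monochromaticIn∩≡# {zero}  S a Q _   = *-identityˡ _
  k^*#monochromaticIn∩≡# {suc m} S a Q Q⊥S = unfolded
    where
    S′ : Fin m → Bool
    S′ = S ∘ suc
    Q[_∷] : Fin k → Colouring m → Bool
    Q[ x ∷] c = Q (x Vector.∷ c)
    Q[∷]⊥S′ : ∀ x → DependsOnlyOutside S′ Q[ x ∷]
    Q[∷]⊥S′ x c c′ c≈c′ = Q⊥S (x Vector.∷ c) (x Vector.∷ c′) (λ { zero _ → refl ; (suc e) S′e → c≈c′ e S′e })
    IH : ∀ x → k ^ count S′ * # (monochromaticIn S′ a ∩ Q[ x ∷]) ≡ # Q[ x ∷]
    IH x = k^*#monochromaticIn∩≡# S′ a Q[ x ∷] (Q[∷]⊥S′ x)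
    -- The goal with #, count and monochromaticIn unfolded once, so that `with` can abstract S zero.
    unfolded : k ^ (indicator (S zero) + count S′)
                 * ∑ k (λ x → # (λ c → ((not (S zero) ∨ ⁅ a ⁆ x) ∧ monochromaticIn S′ a c) ∧ Q[ x ∷] c))
               ≡ ∑ k (λ x → # Q[ x ∷])
    unfolded with S zero in S0
    ... | false = begin
      k ^ count S′ * ∑ k (λ x → # (monochromaticIn S′ a ∩ Q[ x ∷]))
        ≡⟨ ∑-distribˡ-* k (k ^ count S′) _ ⟩
      ∑ k (λ x → k ^ count S′ * # (monochromaticIn S′ a ∩ Q[ x ∷]))
        ≡⟨ ∑-cong k IH ⟩
      ∑ k (λ x → # Q[ x ∷]) ∎
      where open ≡-Reasoning
    ... | true  = begin
      k * k ^ count S′ * ∑ k (λ x → # (λ c → (⁅ a ⁆ x ∧ monochromaticIn S′ a c) ∧ Q[ x ∷] c))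
        ≡⟨ cong (k * k ^ count S′ *_)
             (∑-cong k (λ x → #-cong (λ c → cong ((⁅ a ⁆ x ∧ monochromaticIn S′ a c) ∧_) (Q-ignores-head x c)))) ⟩
      k * k ^ count S′ * ∑ k (λ x → # (λ c → (⁅ a ⁆ x ∧ monochromaticIn S′ a c) ∧ Q[ a ∷] c))
        ≡⟨ cong (k * k ^ count S′ *_) (∑-cong k (λ x → #-if (⁅ a ⁆ x) (monochromaticIn S′ a) Q[ a ∷])) ⟩
      k * k ^ count S′ * ∑ k (λ x → if ⁅ a ⁆ x then # (monochromaticIn S′ a ∩ Q[ a ∷]) else 0)
        ≡⟨ cong (k * k ^ count S′ *_) (∑-⁅⁆ k a _) ⟩
      k * k ^ count S′ * # (monochromaticIn S′ a ∩ Q[ a ∷])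
        ≡⟨ trans (*-assoc k _ _) (cong (k *_) (IH a)) ⟩
      k * # Q[ a ∷]
        ≡⟨ sym (∑-const k _) ⟩
      ∑ k (λ _ → # Q[ a ∷])
        ≡⟨ ∑-cong k (λ x → #-cong (λ c → sym (Q-ignores-head x c))) ⟩
      ∑ k (λ x → # Q[ x ∷]) ∎
      where
      open ≡-Reasoning
      Q-ignores-head : ∀ x c → Q[ x ∷] c ≡ Q[ a ∷] c
      Q-ignores-head x c =
        Q⊥S _ _ (λ { zero S0≡false → ⊥-elim (true≢false S0 S0≡false) ; (suc e) _ → refl })

  k^*#monochromatic∩≤# : ∀ t (S : Fin m → Bool) (Q : Colouring m → Bool) → count S ≡ suc t →
                         DependsOnlyOutside S Q → 0 < k → k ^ t * # (monochromatic S ∩ Q) ≤ # Q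
  k^*#monochromatic∩≤# t S Q ∣S∣≡1+t Q⊥S (s≤s k>0) = *-cancelˡ-≤ k (begin
    k * (k ^ t * # (monochromatic S ∩ Q))
      ≡⟨ sym (*-assoc k (k ^ t) _) ⟩
    k ^ suc t * # (monochromatic S ∩ Q)
      ≤⟨ *-monoʳ-≤ (k ^ suc t) union-bound ⟩
    k ^ suc t * ∑ k (λ a → # (monochromaticIn S a ∩ Q))
      ≡⟨ ∑-distribˡ-* k (k ^ suc t) (λ a → # (monochromaticIn S a ∩ Q)) ⟩
    ∑ k (λ a → k ^ suc t * # (monochromaticIn S a ∩ Q))
      ≡⟨ ∑-cong k (λ a → subst (λ n → k ^ n * # (monochromaticIn S a ∩ Q) ≡ # Q) ∣S∣≡1+t
                                (k^*#monochromaticIn∩≡# S a Q Q⊥S)) ⟩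
    ∑ k (λ _ → # Q)
      ≡⟨ ∑-const k (# Q) ⟩
    k * # Q ∎)
    where
    open ≤-Reasoning
    union-bound : # (monochromatic S ∩ Q) ≤ ∑ k (λ a → # (monochromaticIn S a ∩ Q))
    union-bound = ≤-trans (≤-reflexive (#-cong (λ c → anyᵇ-∧ (λ a → monochromaticIn S a c) (Q c))))
                          (#-anyᵇ k (λ a → monochromaticIn S a ∩ Q))

-- The local lemma, by counting

n*[z+y]≤[1+n]*y : ∀ n z y → suc n * z ≤ z + y → n * (z + y) ≤ suc n * y
n*[z+y]≤[1+n]*y n z y [1+n]z≤z+y = begin
  n * (z + y)    ≡⟨ *-distribˡ-+ n z y ⟩
  n * z + n * y  ≤⟨ +-monoˡ-≤ (n * y) (+-cancelˡ-≤ z (n * z) y [1+n]z≤z+y) ⟩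
  y + n * y      ∎
  where open ≤-Reasoning

^-ratio-monoʳ : ∀ d x y {p K} → p ≤ K → d ^ p * x ≤ suc d ^ p * y → d ^ K * x ≤ suc d ^ K * y
^-ratio-monoʳ d x y {p} {K} p≤K d^px≤ = subst (λ K → d ^ K * x ≤ suc d ^ K * y) (m+[n∸m]≡n p≤K) (begin
  d ^ (p + q) * x          ≡⟨ cong (_* x) (trans (^-distribˡ-+-* d p q) (*-comm (d ^ p) (d ^ q))) ⟩
  d ^ q * d ^ p * x        ≡⟨ *-assoc (d ^ q) (d ^ p) x ⟩
  d ^ q * (d ^ p * x)      ≤⟨ *-mono-≤ (^-monoˡ-≤ q (n≤1+n d)) d^px≤ ⟩
  suc d ^ q * (suc d ^ p * y)  ≡⟨ sym (*-assoc (suc d ^ q) (suc d ^ p) y) ⟩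
  suc d ^ q * suc d ^ p * y    ≡⟨ cong (_* y) (trans (*-comm (suc d ^ q) (suc d ^ p))
                                                       (sym (^-distribˡ-+-* (suc d) p q))) ⟩
  suc d ^ (p + q) * y      ∎)
  where
  open ≤-Reasoning
  q : ℕ
  q = K ∸ p

module CountingLocalLemma {k m M : ℕ} (B : Fin M → Colourings.Colouring k m → Bool) where
  open Colourings k

  avoids : (Fin M → Bool) → Colouring m → Bool
  avoids T c = allᵇ (λ j → not (T j) ∨ not (B j c))

  avoids-antitone : {T T′ : Fin M → Bool} → T′ ⊆ T → avoids T ⊆ avoids T′
  avoids-antitone {T} {T′} T′⊆T c avoidsT = allᵇ-true⁺ _ avoids-j
    where
    avoids-j : ∀ j → (not (T′ j) ∨ not (B j c)) ≡ true
    avoids-j j with T′ j in T′j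
    ... | false = refl
    ... | true  = subst (λ b → not b ∨ not (B j c) ≡ true) (T′⊆T j T′j) (allᵇ-true⁻ _ avoidsT j)

  avoids-cong : {T T′ : Fin M → Bool} → (∀ j → T j ≡ T′ j) → ∀ c → avoids T c ≡ avoids T′ c
  avoids-cong T≡T′ c = allᵇ-cong (λ j → cong (λ b → not b ∨ not (B j c)) (T≡T′ j))

  avoids-─⁅⁆ : ∀ T j → T j ≡ true → ∀ c → avoids T c ≡ not (B j c) ∧ avoids (T ─ ⁅ j ⁆) c
  avoids-─⁅⁆ T j Tj c = ⇔→≡ (mk⇔ to from)
    where
    to : avoids T c ≡ true → not (B j c) ∧ avoids (T ─ ⁅ j ⁆) c ≡ true
    to avoidsT = ∧-true⁺ (subst (λ b → not b ∨ not (B j c) ≡ true) Tj (allᵇ-true⁻ _ avoidsT j))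
                         (avoids-antitone (λ x → ∧-conicalˡ _ _) c avoidsT)
    from : not (B j c) ∧ avoids (T ─ ⁅ j ⁆) c ≡ true → avoids T c ≡ true
    from ¬Bj∧avoids = allᵇ-true⁺ _ avoids-x
      where
      avoids-x : ∀ x → (not (T x) ∨ not (B x c)) ≡ true
      avoids-x x with x ≟ j
      ... | yes refl = ∨-true⁺ʳ {not (T x)} (∧-conicalˡ _ _ ¬Bj∧avoids)
      ... | no  x≢j  = subst (λ b → not b ∨ not (B x c) ≡ true) (─⁅⁆-≢ T x≢j)
                             (allᵇ-true⁻ _ (∧-conicalʳ _ _ ¬Bj∧avoids) x)

  #avoids-─⁅⁆ : ∀ T j → T j ≡ true → # (avoids (T ─ ⁅ j ⁆)) ≡ # (B j ∩ avoids (T ─ ⁅ j ⁆)) + # (avoids T)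
  #avoids-─⁅⁆ T j Tj = trans (#-split (avoids (T ─ ⁅ j ⁆)) (B j))
    (cong₂ _+_ (#-cong (λ c → ∧-comm (avoids (T ─ ⁅ j ⁆) c) (B j c)))
               (#-cong (λ c → sym (trans (avoids-─⁅⁆ T j Tj c) (∧-comm (not (B j c)) _)))))

  module _ (K κ : ℕ) (N : Fin M → Fin M → Bool)
           (N-refl : ∀ i → N i i ≡ true)
           (∣N∣≤1+K : ∀ i → count (N i) ≤ suc K)
           (B-independent : ∀ i T → (∀ j → T j ≡ true → N i j ≡ false) →
                            κ * # (B i ∩ avoids T) ≤ # (avoids T))
           (numerical : suc (suc K) ^ suc K ≤ κ * suc K ^ K) where

    private
      D : ℕ
      D = suc K

    -- P(B i | avoids T) ≤ 1 / (D + 1)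
    Rare : (Fin M → Bool) → Fin M → Set
    Rare T i = suc D * # (B i ∩ avoids T) ≤ # (avoids T)

    D*#avoids-─⁅⁆≤ : ∀ T j → T j ≡ true → Rare (T ─ ⁅ j ⁆) j → D * # (avoids (T ─ ⁅ j ⁆)) ≤ suc D * # (avoids T)
    D*#avoids-─⁅⁆≤ T j Tj rare = subst (λ x → D * x ≤ suc D * # (avoids T)) (sym decomposition)
      (n*[z+y]≤[1+n]*y D Z (# (avoids T)) (subst (suc D * Z ≤_) decomposition rare))
      where
      Z : ℕ
      Z = # (B j ∩ avoids (T ─ ⁅ j ⁆))
      decomposition : # (avoids (T ─ ⁅ j ⁆)) ≡ Z + # (avoids T)
      decomposition = #avoids-─⁅⁆ T j Tj

    module _ (b : ℕ) (rare : ∀ T j → count T < b → T j ≡ false → Rare T j) (i : Fin M) where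

      drop-neighbours : ∀ p T → count (T ∩ N i) ≡ p → count T ≤ b →
                        D ^ p * # (avoids (T ─ N i)) ≤ suc D ^ p * # (avoids T)
      drop-neighbours zero    T ∣T∩N∣≡0 _ =
        ≤-reflexive (cong (_+ 0) (#-cong (avoids-cong (λ j → outside-N j (count≡0⇒false _ ∣T∩N∣≡0 j)))))
        where
        outside-N : ∀ j → T j ∧ N i j ≡ false → T j ∧ not (N i j) ≡ T j
        outside-N j with T j | N i j
        ... | false | _     = λ _ → refl
        ... | true  | false = λ _ → refl
      drop-neighbours (suc p) T ∣T∩N∣≡1+p ∣T∣≤b = begin
        D * D ^ p * # (avoids (T ─ N i))
          ≡⟨ *-assoc D (D ^ p) _ ⟩
        D * (D ^ p * # (avoids (T ─ N i)))
          ≡⟨ cong (λ x → D * (D ^ p * x)) (#-cong (avoids-cong same-outside-N)) ⟩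
        D * (D ^ p * # (avoids (T′ ─ N i)))
          ≤⟨ *-monoʳ-≤ D (drop-neighbours p T′ ∣T′∩N∣≡p (≤-trans (n≤1+n _) ∣T′∣<b)) ⟩
        D * (suc D ^ p * # (avoids T′))
          ≡⟨ *-leftSwap D (suc D ^ p) _ ⟩
        suc D ^ p * (D * # (avoids T′))
          ≤⟨ *-monoʳ-≤ (suc D ^ p) (D*#avoids-─⁅⁆≤ T j Tj (rare T′ j ∣T′∣<b (─-absorb T ⁅ j ⁆ (⁅⁆-self j)))) ⟩
        suc D ^ p * (suc D * # (avoids T))
          ≡⟨ trans (*-leftSwap (suc D ^ p) (suc D) (# (avoids T)))
                   (sym (*-assoc (suc D) (suc D ^ p) (# (avoids T)))) ⟩
        suc D ^ suc p * # (avoids T) ∎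
        where
        open ≤-Reasoning
        j∈T∩N : Σ (Fin M) (λ j → (T ∩ N i) j ≡ true)
        j∈T∩N = count-pos (T ∩ N i) (subst (0 <_) (sym ∣T∩N∣≡1+p) (s≤s z≤n))
        j : Fin M
        j = proj₁ j∈T∩N
        Tj : T j ≡ true
        Tj = ∧-conicalˡ _ _ (proj₂ j∈T∩N)
        Nj : N i j ≡ true
        Nj = ∧-conicalʳ _ _ (proj₂ j∈T∩N)
        T′ : Fin M → Bool
        T′ = T ─ ⁅ j ⁆
        ∣T′∣<b : count T′ < b
        ∣T′∣<b = ≤-trans (≤-reflexive (count-─⁅⁆ T j Tj)) ∣T∣≤b
        ∣T′∩N∣≡p : count (T′ ∩ N i) ≡ p
        ∣T′∩N∣≡p = suc-injective (begin-equality
          suc (count (T′ ∩ N i))          ≡⟨ cong suc (count-cong (λ x → ∧-rightSwap (T x) _ (N i x))) ⟩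
          suc (count ((T ∩ N i) ─ ⁅ j ⁆)) ≡⟨ count-─⁅⁆ (T ∩ N i) j (proj₂ j∈T∩N) ⟩
          count (T ∩ N i)                 ≡⟨ ∣T∩N∣≡1+p ⟩
          suc p                           ∎)
        same-outside-N : ∀ x → (T ─ N i) x ≡ (T′ ─ N i) x
        same-outside-N x = case x ≟ j of λ where
          (yes refl) → trans (─-absorb T (N i) Nj) (sym (─-absorb T′ (N i) Nj))
          (no x≢j)   → cong (λ b → b ∧ not (N i x)) (sym (─⁅⁆-≢ T x≢j))

    rare-step : ∀ b → (∀ T j → count T < b → T j ≡ false → Rare T j) →
                ∀ T i → count T ≤ b → T i ≡ false → Rare T i
    rare-step b rare T i ∣T∣≤b Ti = *-cancelˡ-≤ (κ * D ^ K) {{>-nonZero κD^K>0}} (begin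
      κ * D ^ K * (suc D * y′)     ≤⟨ *-monoʳ-≤ (κ * D ^ K) (*-monoʳ-≤ (suc D) y′≤x′) ⟩
      κ * D ^ K * (suc D * x′)     ≡⟨ identity κ (D ^ K) (suc D) x′ ⟩
      suc D * (D ^ K * (κ * x′))   ≤⟨ *-monoʳ-≤ (suc D) (*-monoʳ-≤ (D ^ K) κx′≤x) ⟩
      suc D * (D ^ K * x)          ≤⟨ *-monoʳ-≤ (suc D) D^Kx≤[1+D]^KY ⟩
      suc D * (suc D ^ K * Y)      ≡⟨ sym (*-assoc (suc D) (suc D ^ K) Y) ⟩
      suc D ^ suc K * Y            ≤⟨ *-monoˡ-≤ Y numerical ⟩
      κ * D ^ K * Y                ∎)
      where
      open ≤-Reasoning
      p x x′ Y y′ : ℕ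
      p  = count (T ∩ N i)
      x  = # (avoids (T ─ N i))
      x′ = # (B i ∩ avoids (T ─ N i))
      Y  = # (avoids T)
      y′ = # (B i ∩ avoids T)
      p≤K : p ≤ K
      p≤K = s≤s⁻¹ (≤-trans (count-< i (λ x → ∧-conicalʳ (T x) _) (N-refl i) (cong (_∧ N i i) Ti)) (∣N∣≤1+K i))
      D^Kx≤[1+D]^KY : D ^ K * x ≤ suc D ^ K * Y
      D^Kx≤[1+D]^KY = ^-ratio-monoʳ D x Y p≤K (drop-neighbours b rare i p T refl ∣T∣≤b)
      κx′≤x : κ * x′ ≤ x
      κx′≤x = B-independent i (T ─ N i) (λ j T─Nj → not-true⁻ (∧-conicalʳ (T j) _ T─Nj))
      y′≤x′ : y′ ≤ x′
      y′≤x′ = #-mono (λ c Bi∧avoidsT → ∧-true⁺ (∧-conicalˡ _ _ Bi∧avoidsT)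
                       (avoids-antitone (λ j → ∧-conicalˡ (T j) _) c (∧-conicalʳ _ _ Bi∧avoidsT)))
      κD^K>0 : 0 < κ * D ^ K
      κD^K>0 = ≤-trans (m^n>0 (suc D) (suc K)) numerical
      identity : ∀ a b c d → a * b * (c * d) ≡ c * (b * (a * d))
      identity = solve-∀

    avoids-pos-empty : 0 < k → ∀ T → count T ≡ 0 → 0 < # (avoids T)
    avoids-pos-empty k>0 T ∣T∣≡0 = ≤-trans (#-true-pos {m} k>0)
      (#-mono (λ c _ → allᵇ-true⁺ _ (λ j → cong (λ b → not b ∨ not (B j c)) (count≡0⇒false T ∣T∣≡0 j))))

    rare : ∀ b T i → count T ≤ b → T i ≡ false → Rare T i
    rare zero    = rare-step zero (λ _ _ ())
    rare (suc b) = rare-step (suc b) (λ T j ∣T∣<1+b → rare b T j (s≤s⁻¹ ∣T∣<1+b))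

    avoids-pos : 0 < k → ∀ b T → count T ≤ b → 0 < # (avoids T)
    avoids-pos k>0 zero    T ∣T∣≤0   = avoids-pos-empty k>0 T (n≤0⇒n≡0 ∣T∣≤0)
    avoids-pos k>0 (suc b) T ∣T∣≤1+b with count T in ∣T∣≡
    ... | zero  = avoids-pos-empty k>0 T ∣T∣≡
    ... | suc _ = >-nonZero⁻¹ (# (avoids T)) {{m*n≢0⇒n≢0 (suc D) {{>-nonZero (begin-strict
      0                     <⟨ avoids-pos k>0 b T′ ∣T′∣≤b ⟩
      # (avoids T′)         ≤⟨ m≤n*m (# (avoids T′)) D ⟩
      D * # (avoids T′)     ≤⟨ D*#avoids-─⁅⁆≤ T j Tj (rare (count T′) T′ j ≤-refl (─-absorb T ⁅ j ⁆ (⁅⁆-self j))) ⟩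
      suc D * # (avoids T)  ∎)}}}}
      where
      open ≤-Reasoning
      j∈T : Σ (Fin M) (λ j → T j ≡ true)
      j∈T = count-pos T (subst (0 <_) (sym ∣T∣≡) (s≤s z≤n))
      j : Fin M
      j = proj₁ j∈T
      Tj : T j ≡ true
      Tj = proj₂ j∈T
      T′ : Fin M → Bool
      T′ = T ─ ⁅ j ⁆
      ∣T′∣≤b : count T′ ≤ b
      ∣T′∣≤b = s≤s⁻¹ (≤-trans (≤-reflexive (trans (count-─⁅⁆ T j Tj) ∣T∣≡)) ∣T∣≤1+b)

    avoiding-colouring : 0 < k → Σ (Colouring m) (λ c → ∀ j → B j c ≡ false)
    avoiding-colouring k>0 with #-pos _ (avoids-pos k>0 M (λ _ → true) (count-≤ (λ _ → true)))
    ... | c , avoids-all = c , λ j → not-true⁻ (allᵇ-true⁻ _ avoids-all j)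

-- Shallow colourings of a uniform hypergraph

length-filter-tabulate : {P : A → Set} (P? : Decidable P) (f : Fin m → A) →
                         length (filter P? (tabulate f)) ≡ count (λ e → does (P? (f e)))
length-filter-tabulate {m = zero}  P? f = refl
length-filter-tabulate {m = suc m} P? f with does (P? (f zero))
... | true  = cong suc (length-filter-tabulate P? (f ∘ suc))
... | false = length-filter-tabulate P? (f ∘ suc)

≤-foldr-⊔-tabulate : (h : Fin m → ℕ) (v : Fin m) → h v ≤ foldr _⊔_ 0 (tabulate h)
≤-foldr-⊔-tabulate h zero    = m≤m⊔n (h zero) _
≤-foldr-⊔-tabulate h (suc v) = ≤-trans (≤-foldr-⊔-tabulate (h ∘ suc) v) (m≤n⊔m (h zero) _)

count-∈? : (p : Subset m) → count (λ v → does (v Subset.∈? p)) ≡ Subset.∣ p ∣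
count-∈? []ᵛ            = refl
count-∈? (true  ∷ᵛ p)  = cong suc (count-∈? p)
count-∈? (false ∷ᵛ p)  = count-∈? p

module Application {n m : ℕ} (H : Hypergraph n m) (r t k : ℕ) where
  open Colourings k

  Δ : ℕ
  Δ = maxDegree H

  incident : Fin n → Fin m → Bool
  incident v e = does (v Subset.∈? edge H e)

  degree≡count : ∀ v → degree H v ≡ count (incident v)
  degree≡count v = length-filter-tabulate (λ e → v Subset.∈? edge H e) (λ e → e)

  count-incident≤Δ : ∀ v → count (incident v) ≤ Δ
  count-incident≤Δ v = subst₂ _≤_ (degree≡count v)
    (cong (foldr _⊔_ 0) (sym (map-tabulate (λ e → e) (degree H)))) (≤-foldr-⊔-tabulate (degree H) v)

  classDegree≡count : ∀ (c : Colouring m) i v → classDegree H c i v ≡ count (λ e → ⁅ i ⁆ (c e) ∧ incident v e)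
  classDegree≡count c i v = length-filter-tabulate (λ e → (c e ≟ i) ×-dec (v Subset.∈? edge H e)) (λ e → e)

  constant-colouring-shallow : (i₀ : Fin k) → Δ ≤ t → AllShallow t H (λ _ → i₀)
  constant-colouring-shallow i₀ Δ≤t i v = subst (_≤ t) (sym (classDegree≡count (λ _ → i₀) i v))
    (≤-trans (count-mono {Q = incident v} (λ e → ∧-conicalʳ (⁅ i ⁆ i₀) _)) (≤-trans (count-incident≤Δ v) Δ≤t))

  events : List (Fin m → Bool)
  events = concat (tabulate (λ v → subsetsOfSize (suc t) (incident v)))

  M : ℕ
  M = length events

  event : Fin M → Fin m → Bool
  event = lookup events

  meet : Fin M → Fin M → Bool
  meet i j = anyᵇ (λ e → event i e ∧ event j e)

  ∣event∣≡1+t : ∀ j → count (event j) ≡ suc t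
  ∣event∣≡1+t j =
    All.lookup (All.concat⁺ (All.tabulate⁺ (λ v → subsetsOfSize-count (suc t) (incident v)))) (∈-lookup j)

  meet-refl : ∀ i → meet i i ≡ true
  meet-refl i with count-pos (event i) (subst (0 <_) (sym (∣event∣≡1+t i)) (s≤s z≤n))
  ... | e , e∈i = anyᵇ-true⁺ _ e (∧-true⁺ e∈i e∈i)

  module _ (uniform : Uniform r H) where

    events-∋≤ : ∀ e → count (λ j → event j e) ≤ r * (Δ C t)
    events-∋≤ e = begin
      count (λ j → event j e)
        ≡⟨ count-lookup (λ S → S e) events ⟩
      countᴸ (λ S → S e) events
        ≡⟨ countᴸ-concat-tabulate n (λ S → S e) _ ⟩
      ∑ n (λ v → countᴸ (λ S → S e) (subsetsOfSize (suc t) (incident v)))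
        ≤⟨ ∑-mono-≤ n (λ v → ≤-trans (∋-subsetsOfSize-suc t (incident v) e)
                               (*-monoʳ-≤ (indicator (incident v e)) (C-monoˡ-≤ t (count-incident≤Δ v)))) ⟩
      ∑ n (λ v → indicator (incident v e) * (Δ C t))
        ≡⟨ sym (∑-distribʳ-* n (Δ C t) (λ v → indicator (incident v e))) ⟩
      count (λ v → incident v e) * (Δ C t)
        ≡⟨ cong (_* (Δ C t)) (trans (count-∈? (edge H e)) (uniform e)) ⟩
      r * (Δ C t) ∎
      where open ≤-Reasoning

    ∣meet∣≤ : ∀ i → count (meet i) ≤ suc t * r * (Δ C t)
    ∣meet∣≤ i = begin
      count (meet i)
        ≤⟨ count-anyᵇ m (λ e j → event i e ∧ event j e) ⟩
      ∑ m (λ e → count (λ j → event i e ∧ event j e))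
        ≤⟨ ∑-mono-≤ m via-edge ⟩
      ∑ m (λ e → indicator (event i e) * (r * (Δ C t)))
        ≡⟨ sym (∑-distribʳ-* m (r * (Δ C t)) (indicator ∘ event i)) ⟩
      count (event i) * (r * (Δ C t))
        ≡⟨ trans (cong (_* (r * (Δ C t))) (∣event∣≡1+t i)) (sym (*-assoc (suc t) r (Δ C t))) ⟩
      suc t * r * (Δ C t) ∎
      where
      open ≤-Reasoning
      via-edge : ∀ e → count (λ j → event i e ∧ event j e) ≤ indicator (event i e) * (r * (Δ C t))
      via-edge e with event i e
      ... | true  = ≤-trans (events-∋≤ e) (≤-reflexive (sym (+-identityʳ _)))
      ... | false = ≤-reflexive (∑-zero M)

  open CountingLocalLemma (λ j → monochromatic (event j))

  k^t*#monochromatic∩avoids≤ : 0 < k → ∀ i T → (∀ j → T j ≡ true → meet i j ≡ false) →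
                               k ^ t * # (monochromatic (event i) ∩ avoids T) ≤ # (avoids T)
  k^t*#monochromatic∩avoids≤ k>0 i T T∩meet≡∅ =
    k^*#monochromatic∩≤# t (event i) (avoids T) (∣event∣≡1+t i) avoids-T⊥event k>0
    where
    avoids-T⊥event : DependsOnlyOutside (event i) (avoids T)
    avoids-T⊥event c c′ c≈c′ = allᵇ-cong same-j
      where
      same-j : ∀ j → (not (T j) ∨ not (monochromatic (event j) c))
                   ≡ (not (T j) ∨ not (monochromatic (event j) c′))
      same-j j with T j in Tj
      ... | false = refl
      ... | true  = cong not (monochromatic-cong (event j) (λ e e∈j → c≈c′ e (disjoint e e∈j)))
        where
        disjoint : ∀ e → event j e ≡ true → event i e ≡ false
        disjoint e e∈j = trans (sym (∧-identityʳ (event i e)))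
          (subst (λ b → event i e ∧ b ≡ false) e∈j (anyᵇ-false⁻ _ (T∩meet≡∅ j Tj) e))

  avoids-all⇒shallow : ∀ (c : Colouring m) → (∀ j → monochromatic (event j) c ≡ false) → AllShallow t H c
  avoids-all⇒shallow c no-mono i v with classDegree H c i v ≤? t
  ... | yes shallow = shallow
  ... | no  deep    = ⊥-elim (true≢false (anyᵇ-true⁺ _ i (allᵇ-true⁺ _ inside-class)) (no-mono j))
    where
    t<∣incident∩class∣ : suc t ≤ count (incident v ∩ (λ e → ⁅ i ⁆ (c e)))
    t<∣incident∩class∣ = subst (suc t ≤_)
      (trans (classDegree≡count c i v) (count-cong (λ e → ∧-comm (⁅ i ⁆ (c e)) (incident v e)))) (≰⇒> deep)
    j∈events : Any (_⊆ (λ e → ⁅ i ⁆ (c e))) events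
    j∈events = Any.concat⁺ (Any.tabulate⁺ v (subsetsOfSize-⊆ (suc t) (incident v) _ t<∣incident∩class∣))
    j : Fin M
    j = Any.index j∈events
    inside-class : ∀ e → (not (event j e) ∨ ⁅ i ⁆ (c e)) ≡ true
    inside-class e with event j e in e∈j
    ... | false = refl
    ... | true  = Any.lookup-index j∈events e e∈j

  shallow-colouring : Uniform r H → 1 ≤ r → 0 < k → e* (r * (t + 1) * Δ ^ t) ≤ (t ! * k ^ t) →
                      Σ (Colouring m) (AllShallow t H)
  shallow-colouring uniform r>0 k>0 e*≤ with Δ ≤? t
  ... | yes Δ≤t = (λ _ → fromℕ< k>0) , constant-colouring-shallow (fromℕ< k>0) Δ≤t
  ... | no  Δ≰t = c , avoids-all⇒shallow c no-mono
    where
    D K : ℕ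
    D = suc t * r * (Δ C t)
    D>0 : 0 < D
    D>0 = *-mono-≤ (*-mono-≤ (s≤s (z≤n {t})) r>0) (C-pos Δ t (<⇒≤ (≰⇒> Δ≰t)))
    K = pred D
    1+K≡D : suc K ≡ D
    1+K≡D = suc-pred D {{>-nonZero D>0}}
    Dt!≤ : suc K * t ! ≤ r * (t + 1) * Δ ^ t
    Dt!≤ = begin
      suc K * t !                     ≡⟨ cong (_* t !) 1+K≡D ⟩
      suc t * r * (Δ C t) * t !       ≡⟨ identity t r (Δ C t) (t !) ⟩
      r * (t + 1) * ((Δ C t) * t !)   ≤⟨ *-monoʳ-≤ (r * (t + 1)) (C*!≤^ Δ t) ⟩
      r * (t + 1) * Δ ^ t             ∎
      where
      open ≤-Reasoning
      identity : ∀ t r c f → suc t * r * c * f ≡ r * (t + 1) * (c * f)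
      identity = solve-∀
    avoiding : Σ (Colouring m) (λ c → ∀ j → monochromatic (event j) c ≡ false)
    avoiding = avoiding-colouring K (k ^ t) meet meet-refl
                 (λ i → subst (count (meet i) ≤_) (sym 1+K≡D) (∣meet∣≤ uniform i))
                 (k^t*#monochromatic∩avoids≤ k>0)
                 (e*≤⇒symmetricCondition K (t !) (k ^ t) _ Dt!≤ e*≤ (1≤n! t)) k>0
    c : Colouring m
    c = proj₁ avoiding
    no-mono : ∀ j → monochromatic (event j) c ≡ false
    no-mono = proj₂ avoiding

lemma3p1 : (r t k : ℕ) → 2 ≤ r → 1 ≤ t → 1 ≤ k →
    (n m : ℕ) (H : Hypergraph n m) → Uniform r H →
    e* (r * (t + 1) * maxDegree H ^ t) ≤ (t ! * k ^ t) →
    Σ (Fin m → Fin k) (λ c → AllShallow t H c)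
lemma3p1 r t k 2≤r _ k≥1 n m H uniform e*≤ =
  Application.shallow-colouring H r t k uniform (≤-trans (s≤s z≤n) 2≤r) k≥1 e*≤
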